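{- Let $\omega$ be an affine permutation whose inversion graph $G(\omega)$ is connected. Then $G(\omega)$ has an induced subgraph that is a doubly infinite path.
   Context: An affine permutation of size $n$ is a bijection $\omega:\mathbb{Z}\to\mathbb{Z}$ with $\omega(i+n)=\omega(i)+n$ for all $i$ and $\sum_{i=1}^n\omega(i)=\sum_{i=1}^ni$. The inversion graph $G(\omega)$ has vertex set $\mathbb{Z}$ and an edge $\{i,j\}$ whenever $i<j$ and $\omega(i)>\omega(j)$. -}

module Defs where

open import Data.Nat using (ℕ; zero; suc)
open import Data.Integer using (ℤ; +_; _+_; _-_; _<_; ∣_∣)
open import Data.Product using (Σ; _×_; _,_)
open import Data.Sum using (_⊎_)
open import Function.Definitions using (Bijective; Injective)
open import Relation.Binary.PropositionalEquality using (_≡_)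

sumFrom1 : ℕ → (ℤ → ℤ) → ℤ
sumFrom1 zero    f = + 0
sumFrom1 (suc k) f = sumFrom1 k f + f (+ suc k)

record IsAffinePerm (n : ℕ) (ω : ℤ → ℤ) : Set where
  field
    bijective : Bijective _≡_ _≡_ ω
    periodic  : ∀ i → ω (i + + n) ≡ ω i + + n
    sumCond   : sumFrom1 n ω ≡ sumFrom1 n (λ i → i)

Inv : (ℤ → ℤ) → ℤ → ℤ → Set
Inv ω i j = i < j × ω j < ω i

Adj : (ℤ → ℤ) → ℤ → ℤ → Set
Adj ω i j = Inv ω i j ⊎ Inv ω j i

data Walk (ω : ℤ → ℤ) : ℤ → ℤ → Set where
  here : ∀ {x} → Walk ω x x
  step : ∀ {x y z} → Adj ω x y → Walk ω y z → Walk ω x z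

Connected : (ℤ → ℤ) → Set
Connected ω = ∀ i j → Walk ω i j

HasInducedBiInfinitePath : (ℤ → ℤ) → Set
HasInducedBiInfinitePath ω =
  Σ (ℤ → ℤ) λ p →
    Injective _≡_ _≡_ p ×
    (∀ a b → (Adj ω (p a) (p b) → ∣ a - b ∣ ≡ 1) × (∣ a - b ∣ ≡ 1 → Adj ω (p a) (p b)))

module Submission where

-- Lemma 5.5: if the inversion graph G(ω) of an affine permutation ω of size n ≥ 1 is connected,
-- then G(ω) contains an induced doubly infinite path.  (Only bijectivity and ω (i + n) = ω i + n
-- are used.)
--
-- Connectivity means that every cut between k and k + 1 is crossed by an inversion, and
-- periodicity bounds the displacement ∣ω i - i∣.  So the maxima
--   M c = max { ω i ∣ i ≤ c }   and   L v = max { j ∣ ω j < v }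
-- exist, and the staircase step T c = L (M c) - 1 satisfies c < T c and M c < M (T c).
-- T commutes with translation by n, hence (pigeonhole on residues mod n) has a bi-infinite
-- orbit (X t)_{t ∈ ℤ}.  With x_t the position of the maximum M (X t) and y_t = L (M (X t)),
-- the only inversions among these points are x_t ~ y_t and x_{t+1} ~ y_t, so
-- …, x_t, y_t, x_{t+1}, y_{t+1}, … is an induced doubly infinite path.

open import Defs
open import Data.Nat as ℕ using (ℕ; zero; suc; NonZero)
import Data.Nat.Properties as ℕP
open import Data.Integer as ℤ
  using (ℤ; +_; -[1+_]; 0ℤ; 1ℤ; _+_; _-_; _*_; -_; ∣_∣; _<_; _≤_; _/ℕ_; _%ℕ_)
  renaming (suc to sucℤ; pred to predℤ)
import Data.Integer.Properties as ℤP
open import Data.Integer.DivMod using (n%ℕd<d; a≡a%ℕn+[a/ℕn]*n)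
open import Data.Integer.Tactic.RingSolver using (solve-∀)
open import Data.Fin using (toℕ; fromℕ<)
open import Data.Fin.Properties using (pigeonhole; fromℕ<-injective)
open import Data.Product using (∃; ∃-syntax; Σ-syntax; _×_; _,_; proj₁; proj₂)
open import Data.Sum using (_⊎_; inj₁; inj₂)
open import Data.Empty using (⊥-elim)
open import Function.Definitions using (Bijective; Injective)
open import Relation.Nullary using (¬_; yes; no)
open import Relation.Unary using (Decidable)
open import Relation.Binary.Definitions using (tri<; tri≈; tri>)
open import Relation.Binary.PropositionalEquality
  using (_≡_; _≢_; refl; sym; trans; cong; subst; subst₂; module ≡-Reasoning)

i≡j+[i-j] : ∀ i j → i ≡ j + (i - j)
i≡j+[i-j] = solve-∀

[i+d]-d≡i : ∀ i d → i + d - d ≡ i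
[i+d]-d≡i = solve-∀

[i-d]+d≡i : ∀ i d → i - d + d ≡ i
[i-d]+d≡i = solve-∀

suc[i+k]≡i+suc[k] : ∀ i k → 1ℤ + (i + k) ≡ i + (1ℤ + k)
suc[i+k]≡i+suc[k] = solve-∀

≤⇒<⊎≡ : ∀ {i j} → i ≤ j → i < j ⊎ i ≡ j
≤⇒<⊎≡ {i} {j} i≤j with i ℤ.≟ j
... | yes i≡j = inj₂ i≡j
... | no  i≢j = inj₁ (ℤP.≤∧≢⇒< i≤j i≢j)

≤⇒offset : ∀ {i j} → i ≤ j → ∃[ k ] j ≡ i + + k
≤⇒offset {i} {j} i≤j = ∣ i - j ∣ , trans (i≡j+[i-j] j i) (cong (_+_ i) (sym (ℤP.∣-∣-≤ i≤j)))

+d<⇒<-d : ∀ {i j} d → i + d < j → i < j - d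
+d<⇒<-d {i} {j} d i+d<j = subst (_< j - d) ([i+d]-d≡i i d) (ℤP.+-monoˡ-< (- d) i+d<j)

≤+d⇒-d≤ : ∀ {i j} d → i ≤ j + d → i - d ≤ j
≤+d⇒-d≤ {i} {j} d i≤j+d = subst (i - d ≤_) ([i+d]-d≡i j d) (ℤP.+-monoˡ-≤ (- d) i≤j+d)

<+d⇒-d< : ∀ {i j} d → i < j + d → i - d < j
<+d⇒-d< {i} {j} d i<j+d = subst (i - d <_) ([i+d]-d≡i j d) (ℤP.+-monoˡ-< (- d) i<j+d)

∣i-j∣≤⇒i≤j+ : ∀ {i j D} → ∣ i - j ∣ ℕ.≤ D → i ≤ j + + D
∣i-j∣≤⇒i≤j+ {i} {j} {D} bound = begin
  i                   ≡⟨ i≡j+[i-j] i j ⟩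
  j + (i - j)         ≤⟨ ℤP.+-monoʳ-≤ j (i≤+∣i∣ (i - j)) ⟩
  j + + ∣ i - j ∣     ≤⟨ ℤP.+-monoʳ-≤ j (ℤ.+≤+ bound) ⟩
  j + + D             ∎
  where
  open ℤP.≤-Reasoning
  i≤+∣i∣ : ∀ i → i ≤ + ∣ i ∣
  i≤+∣i∣ (+ _)     = ℤP.≤-refl
  i≤+∣i∣ -[1+ _ ]  = ℤ.-≤+

Greatest : (ℤ → Set) → ℤ → Set
Greatest P y = P y × (∀ j → y < j → ¬ P j)

greatest : (P : ℤ → Set) → Decidable P → ∀ {j₀} → P j₀ →
           ∀ k → (∀ j → j₀ + + k < j → ¬ P j) → ∃ (Greatest P)
greatest P P? {j₀} Pj₀ zero beyond =
  j₀ , Pj₀ , λ j j₀<j → beyond j (subst (_< j) (sym (ℤP.+-identityʳ j₀)) j₀<j)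
greatest P P? {j₀} Pj₀ (suc k) beyond with P? (j₀ + + suc k)
... | yes Ptop = j₀ + + suc k , Ptop , beyond
... | no ¬Ptop = greatest P P? Pj₀ k beyond′
  where
  beyond′ : ∀ j → j₀ + + k < j → ¬ P j
  beyond′ j lt with ≤⇒<⊎≡ (ℤP.i<j⇒suc[i]≤j lt)
  ... | inj₁ top<j = beyond j (subst (_< j) (suc[i+k]≡i+suc[k] j₀ (+ k)) top<j)
  ... | inj₂ refl  = subst (λ i → ¬ P i) (sym (suc[i+k]≡i+suc[k] j₀ (+ k))) ¬Ptop

greatest-unique : ∀ {P y z} → Greatest P y → Greatest P z → y ≡ z
greatest-unique {y = y} {z} (Py , above-y) (Pz , above-z) with ℤP.<-cmp y z
... | tri< y<z _ _ = ⊥-elim (above-y z y<z Pz)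
... | tri≈ _ y≡z _ = y≡z
... | tri> _ _ z<y = ⊥-elim (above-z y z<y Py)

greatest-translate : ∀ {P Q : ℤ → Set} {y} d →
  (∀ j → P j → Q (j + d)) → (∀ j → Q j → P (j - d)) → Greatest P y → Greatest Q (y + d)
greatest-translate d P⇒Q Q⇒P (Py , above) =
  P⇒Q _ Py , λ j y+d<j Qj → above (j - d) (+d<⇒<-d d y+d<j) (Q⇒P j Qj)

Commutes : (ℤ → ℤ) → ℤ → Set
Commutes g d = ∀ i → g (i + d) ≡ g i + d

module _ (g : ℤ → ℤ) where

  commutes-neg : ∀ {d} → Commutes g d → Commutes g (- d)
  commutes-neg {d} g-d i = begin
    g (i - d)              ≡⟨ [i+d]-d≡i (g (i - d)) d ⟨
    g (i - d) + d - d      ≡⟨ cong (_- d) (g-d (i - d)) ⟨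
    g (i - d + d) - d      ≡⟨ cong (λ j → g j - d) ([i-d]+d≡i i d) ⟩
    g i - d                ∎
    where open ≡-Reasoning

  commutes-+ : ∀ {d e} → Commutes g d → Commutes g e → Commutes g (d + e)
  commutes-+ {d} {e} g-d g-e i = begin
    g (i + (d + e))        ≡⟨ cong g (ℤP.+-assoc i d e) ⟨
    g (i + d + e)          ≡⟨ g-e (i + d) ⟩
    g (i + d) + e          ≡⟨ cong (_+ e) (g-d i) ⟩
    g i + d + e            ≡⟨ ℤP.+-assoc (g i) d e ⟩
    g i + (d + e)          ∎
    where open ≡-Reasoning

  commutes-*ℕ : ∀ {d} → Commutes g d → ∀ k → Commutes g (+ k * d)
  commutes-*ℕ {d} g-d zero    i = trans (cong g (ℤP.+-identityʳ i)) (sym (ℤP.+-identityʳ (g i)))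
  commutes-*ℕ {d} g-d (suc k)   =
    subst (Commutes g) (sym (ℤP.suc-* (+ k) d)) (commutes-+ g-d (commutes-*ℕ g-d k))

  commutes-* : ∀ {d} → Commutes g d → ∀ q → Commutes g (q * d)
  commutes-* g-d (+ k)     = commutes-*ℕ g-d k
  commutes-* {d} g-d -[1+ k ] =
    subst (Commutes g) (ℤP.neg-distribˡ-* (+ suc k) d) (commutes-neg (commutes-*ℕ g-d (suc k)))

iterate : {A : Set} → (A → A) → ℕ → A → A
iterate g zero    x = x
iterate g (suc t) x = g (iterate g t x)

iterate-+ : ∀ {A : Set} (g : A → A) s t x → iterate g (s ℕ.+ t) x ≡ iterate g s (iterate g t x)
iterate-+ g zero    t x = refl
iterate-+ g (suc s) t x = cong g (iterate-+ g s t x)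

iterate-suc : ∀ {A : Set} (g : A → A) t x → iterate g (suc t) x ≡ iterate g t (g x)
iterate-suc g zero    x = refl
iterate-suc g (suc t) x = cong g (iterate-suc g t x)

same-residue⇒multiple : ∀ n .{{_ : NonZero n}} a b → a %ℕ n ≡ b %ℕ n →
  b ≡ a + (b /ℕ n - a /ℕ n) * + n
same-residue⇒multiple n a b same = begin
  b                                              ≡⟨ a≡a%ℕn+[a/ℕn]*n b n ⟩
  + (b %ℕ n) + b /ℕ n * + n                      ≡⟨ cong (λ r → + r + b /ℕ n * + n) same ⟨
  + (a %ℕ n) + b /ℕ n * + n                      ≡⟨ regroup (+ (a %ℕ n)) (a /ℕ n) (b /ℕ n) (+ n) ⟩
  + (a %ℕ n) + a /ℕ n * + n + (b /ℕ n - a /ℕ n) * + n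
                                                 ≡⟨ cong (_+ (b /ℕ n - a /ℕ n) * + n) (a≡a%ℕn+[a/ℕn]*n a n) ⟨
  a + (b /ℕ n - a /ℕ n) * + n                    ∎
  where
  open ≡-Reasoning
  regroup : ∀ r qa qb m → r + qb * m ≡ r + qa * m + (qb - qa) * m
  regroup = solve-∀

residues-collide : ∀ n .{{_ : NonZero n}} (f : ℕ → ℤ) →
  ∃[ i ] ∃[ j ] i ℕ.< j × f i %ℕ n ≡ f j %ℕ n
residues-collide n f with pigeonhole (ℕP.n<1+n n) (λ i → fromℕ< (n%ℕd<d (f (toℕ i)) n))
... | i , j , i<j , same = toℕ i , toℕ j , i<j , fromℕ<-injective _ _ _ _ same

returning-point : ∀ n .{{_ : NonZero n}} (g : ℤ → ℤ) →
  ∃[ x ] ∃[ p ] ∃[ q ] iterate g (suc p) x ≡ x + q * + n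
returning-point n g with residues-collide n (λ t → iterate g t 0ℤ)
... | i , j , i<j , same with ℕP.m≤n⇒∃[o]m+o≡n i<j
...   | p , i+p+1≡j = x , p , q , (begin
  iterate g (suc p) x           ≡⟨ iterate-+ g (suc p) i 0ℤ ⟨
  iterate g (suc p ℕ.+ i) 0ℤ    ≡⟨ cong (λ t → iterate g (suc t) 0ℤ) (ℕP.+-comm p i) ⟩
  iterate g (suc i ℕ.+ p) 0ℤ    ≡⟨ cong (λ t → iterate g t 0ℤ) i+p+1≡j ⟩
  iterate g j 0ℤ                ≡⟨ same-residue⇒multiple n x (iterate g j 0ℤ) same ⟩
  x + q * + n                   ∎)
  where
  open ≡-Reasoning
  x : ℤ
  x = iterate g i 0ℤ
  q : ℤ
  q = iterate g j 0ℤ /ℕ n - x /ℕ n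

-- A point whose orbit returns translated by d, for a map commuting with translation by d,
-- has a predecessor with the same property; hence its orbit extends to all of ℤ.
module Returning (g : ℤ → ℤ) {d : ℤ} (g-d : Commutes g d) (p : ℕ) where

  Returns : ℤ → Set
  Returns x = iterate g (suc p) x ≡ x + d

  pre : ℤ → ℤ
  pre x = iterate g p x - d

  g-pre : ∀ {x} → Returns x → g (pre x) ≡ x
  g-pre {x} returns = begin
    g (iterate g p x - d)        ≡⟨ commutes-neg g g-d (iterate g p x) ⟩
    iterate g (suc p) x - d      ≡⟨ cong (_- d) returns ⟩
    x + d - d                    ≡⟨ [i+d]-d≡i x d ⟩
    x                            ∎
    where open ≡-Reasoning

  pre-returns : ∀ {x} → Returns x → Returns (pre x)
  pre-returns {x} returns = begin
    iterate g (suc p) (pre x)    ≡⟨ iterate-suc g p (pre x) ⟩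
    iterate g p (g (pre x))      ≡⟨ cong (iterate g p) (g-pre returns) ⟩
    iterate g p x                ≡⟨ [i-d]+d≡i (iterate g p x) d ⟨
    pre x + d                    ∎
    where open ≡-Reasoning

  pre^-returns : ∀ {x} → Returns x → ∀ m → Returns (iterate pre m x)
  pre^-returns returns zero    = returns
  pre^-returns returns (suc m) = pre-returns (pre^-returns returns m)

  orbit : ℤ → ℤ → ℤ
  orbit x (+ m)     = iterate g m x
  orbit x -[1+ m ]  = iterate pre (suc m) x

  orbit-step : ∀ {x} → Returns x → ∀ t → orbit x (sucℤ t) ≡ g (orbit x t)
  orbit-step returns (+ m)          = refl
  orbit-step returns -[1+ zero ]    = sym (g-pre returns)
  orbit-step returns -[1+ suc m ]   = sym (g-pre (pre^-returns returns (suc m)))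

-- A map commuting with translation by n ≥ 1 has a bi-infinite orbit.
-- (Opaque, like the other existence proofs below: only the statement is ever used.)
opaque
  bi-infinite-orbit : ∀ n .{{_ : NonZero n}} (g : ℤ → ℤ) → Commutes g (+ n) →
    Σ[ X ∈ (ℤ → ℤ) ] ∀ t → X (sucℤ t) ≡ g (X t)
  bi-infinite-orbit n g g-n with returning-point n g
  ... | x , p , q , returns = orbit x , orbit-step returns
    where open Returning g (commutes-* g g-n q) p

sum< : (ℕ → ℕ) → ℕ → ℕ
sum< f zero    = 0
sum< f (suc m) = sum< f m ℕ.+ f m

term≤sum< : ∀ f {r m} → r ℕ.< m → f r ℕ.≤ sum< f m
term≤sum< f {r} {suc m} r<1+m with ℕP.m≤n⇒m<n∨m≡n (ℕ.s≤s⁻¹ r<1+m)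
... | inj₁ r<m  = ℕP.≤-trans (term≤sum< f r<m) (ℕP.m≤m+n _ _)
... | inj₂ refl = ℕP.m≤n+m _ _

-- A map commuting with translation by n ≥ 1 moves points a bounded distance:
-- its displacement g i - i only depends on i mod n.
opaque
  bounded-displacement : ∀ n .{{_ : NonZero n}} (g : ℤ → ℤ) → Commutes g (+ n) →
    Σ[ D ∈ ℕ ] ∀ i → ∣ g i - i ∣ ℕ.≤ D
  bounded-displacement n g g-n = sum< displacement n , bound
    where
    displacement : ℕ → ℕ
    displacement r = ∣ g (+ r) - + r ∣

    reduce : ∀ i → g (+ (i %ℕ n)) - + (i %ℕ n) ≡ g i - i
    reduce i = begin
      g r - r                      ≡⟨ cancel (g r) r (i /ℕ n * + n) ⟩
      g r + q - (r + q)            ≡⟨ cong (_- (r + q)) (commutes-* g g-n (i /ℕ n) r) ⟨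
      g (r + q) - (r + q)          ≡⟨ cong (λ j → g j - j) (a≡a%ℕn+[a/ℕn]*n i n) ⟨
      g i - i                      ∎
      where
      open ≡-Reasoning
      r q : ℤ
      r = + (i %ℕ n)
      q = i /ℕ n * + n
      cancel : ∀ a b c → a - b ≡ a + c - (b + c)
      cancel = solve-∀

    bound : ∀ i → ∣ g i - i ∣ ℕ.≤ sum< displacement n
    bound i = subst (ℕ._≤ _) (cong ∣_∣ (reduce i)) (term≤sum< displacement (n%ℕd<d i n))

Increasing : (ℤ → ℤ) → Set
Increasing X = ∀ t → X t < X (sucℤ t)

increasing⇒< : ∀ {X} → Increasing X → ∀ {s t} → s < t → X s < X t
increasing⇒< {X} X↑ {s} s<t with ≤⇒offset (ℤP.i<j⇒suc[i]≤j s<t)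
... | k , refl = from-next k
  where
  from-next : ∀ k → X s < X (sucℤ s + + k)
  from-next zero    = subst (λ u → X s < X u) (sym (ℤP.+-identityʳ (sucℤ s))) (X↑ s)
  from-next (suc k) = ℤP.<-trans (from-next k)
    (subst (λ u → X (sucℤ s + + k) < X u) (suc[i+k]≡i+suc[k] (sucℤ s) (+ k)) (X↑ _))

increasing⇒≤ : ∀ {X} → Increasing X → ∀ {s t} → s ≤ t → X s ≤ X t
increasing⇒≤ X↑ s≤t with ≤⇒<⊎≡ s≤t
... | inj₁ s<t  = ℤP.<⇒≤ (increasing⇒< X↑ s<t)
... | inj₂ refl = ℤP.≤-refl

∣d+d∣≢1 : ∀ d → ∣ d + d ∣ ≢ 1
∣d+d∣≢1 (+ zero)   ()
∣d+d∣≢1 (+ suc k)  e = ℕP.m+1+n≢0 k (ℕP.suc-injective e)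
∣d+d∣≢1 -[1+ k ]   ()

∣d+d-1∣≡1⇒ : ∀ d → ∣ d + d - 1ℤ ∣ ≡ 1 → d ≡ 0ℤ ⊎ d ≡ 1ℤ
∣d+d-1∣≡1⇒ (+ zero)          _ = inj₁ refl
∣d+d-1∣≡1⇒ (+ suc zero)      _ = inj₂ refl
∣d+d-1∣≡1⇒ (+ suc (suc k))   e = ⊥-elim (ℕP.m+1+n≢0 k (ℕP.suc-injective e))
∣d+d-1∣≡1⇒ -[1+ k ]          ()

∣e-1∣≡1∧∣e+1∣≡1⇒e≡0 : ∀ e → ∣ e - 1ℤ ∣ ≡ 1 → ∣ e + 1ℤ ∣ ≡ 1 → e ≡ 0ℤ
∣e-1∣≡1∧∣e+1∣≡1⇒e≡0 (+ zero)   _ _  = refl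
∣e-1∣≡1∧∣e+1∣≡1⇒e≡0 (+ suc k)  _ e+1 = ⊥-elim (ℕP.m+1+n≢0 k (ℕP.suc-injective e+1))
∣e-1∣≡1∧∣e+1∣≡1⇒e≡0 -[1+ k ]   e-1 _ with ℕP.suc-injective e-1
... | ()

data Parity : ℤ → Set where
  even : ∀ t → Parity (t + t)
  odd  : ∀ t → Parity (sucℤ (t + t))

opaque
  parity : ∀ a → Parity a
  parity a with a %ℕ 2 | n%ℕd<d a 2 | a≡a%ℕn+[a/ℕn]*n a 2
  ... | zero          | _                   | a≡ = subst Parity (sym (trans a≡ (twice (a /ℕ 2)))) (even (a /ℕ 2))
    where
    twice : ∀ t → 0ℤ + t * (1ℤ + 1ℤ) ≡ t + t
    twice = solve-∀
  ... | suc zero      | _                   | a≡ = subst Parity (sym (trans a≡ (twice+1 (a /ℕ 2)))) (odd (a /ℕ 2))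
    where
    twice+1 : ∀ t → 1ℤ + t * (1ℤ + 1ℤ) ≡ 1ℤ + (t + t)
    twice+1 = solve-∀
  ... | suc (suc _)   | ℕ.s≤s (ℕ.s≤s ())  | _

IsInducedPath : {A : Set} → (A → A → Set) → (ℤ → A) → Set
IsInducedPath R p = ∀ a b → (R (p a) (p b) → ∣ a - b ∣ ≡ 1) × (∣ a - b ∣ ≡ 1 → R (p a) (p b))

-- An induced doubly infinite path never revisits a vertex: p b is adjacent to both
-- neighbours p (a - 1) and p (a + 1) of p a = p b, which forces b = a.
induced-path-injective : ∀ {A : Set} {R : A → A → Set} {p : ℤ → A} →
  IsInducedPath R p → Injective _≡_ _≡_ p
induced-path-injective {R = R} {p} path {a} {b} pa≡pb =
  sym (ℤP.i-j≡0⇒i≡j b a (∣e-1∣≡1∧∣e+1∣≡1⇒e≡0 (b - a) below above))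
  where
  near : ∀ c {e} → b - c ≡ e → ∣ a - c ∣ ≡ 1 → ∣ e ∣ ≡ 1
  near c refl ∣a-c∣≡1 =
    proj₁ (path b c) (subst (λ u → R u (p c)) pa≡pb (proj₂ (path a c) ∣a-c∣≡1))
  b-[a+1] : ∀ a b → b - (1ℤ + a) ≡ b - a - 1ℤ
  b-[a+1] = solve-∀
  b-[a-1] : ∀ a b → b - (- 1ℤ + a) ≡ b - a + 1ℤ
  b-[a-1] = solve-∀
  a-[a+1] : ∀ a → a - (1ℤ + a) ≡ - 1ℤ
  a-[a+1] = solve-∀
  a-[a-1] : ∀ a → a - (- 1ℤ + a) ≡ 1ℤ
  a-[a-1] = solve-∀
  below : ∣ b - a - 1ℤ ∣ ≡ 1
  below = near (sucℤ a) (b-[a+1] a b) (cong ∣_∣ (a-[a+1] a))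
  above : ∣ b - a + 1ℤ ∣ ≡ 1
  above = near (predℤ a) (b-[a-1] a b) (cong ∣_∣ (a-[a-1] a))

nonadjacent-even-even : ∀ s t → ∣ s + s - (t + t) ∣ ≢ 1
nonadjacent-even-even s t e = ∣d+d∣≢1 (s - t) (trans (cong ∣_∣ (sym (diff s t))) e)
  where
  diff : ∀ s t → s + s - (t + t) ≡ (s - t) + (s - t)
  diff = solve-∀

nonadjacent-odd-odd : ∀ s t → ∣ sucℤ (s + s) - sucℤ (t + t) ∣ ≢ 1
nonadjacent-odd-odd s t e = ∣d+d∣≢1 (s - t) (trans (cong ∣_∣ (sym (diff s t))) e)
  where
  diff : ∀ s t → 1ℤ + (s + s) - (1ℤ + (t + t)) ≡ (s - t) + (s - t)
  diff = solve-∀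

adjacent-even-odd : ∀ {s t} → s ≡ t ⊎ s ≡ sucℤ t → ∣ s + s - sucℤ (t + t) ∣ ≡ 1
adjacent-even-odd {t = t} (inj₁ refl) = cong ∣_∣ (diff t)
  where
  diff : ∀ t → t + t - (1ℤ + (t + t)) ≡ - 1ℤ
  diff = solve-∀
adjacent-even-odd {t = t} (inj₂ refl) = cong ∣_∣ (diff t)
  where
  diff : ∀ t → (1ℤ + t) + (1ℤ + t) - (1ℤ + (t + t)) ≡ 1ℤ
  diff = solve-∀

adjacent-even-odd⁻¹ : ∀ s t → ∣ s + s - sucℤ (t + t) ∣ ≡ 1 → s ≡ t ⊎ s ≡ sucℤ t
adjacent-even-odd⁻¹ s t e with ∣d+d-1∣≡1⇒ (s - t) (trans (cong ∣_∣ (sym (diff s t))) e)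
  where
  diff : ∀ s t → s + s - (1ℤ + (t + t)) ≡ (s - t) + (s - t) - 1ℤ
  diff = solve-∀
... | inj₁ s-t≡0 = inj₁ (ℤP.i-j≡0⇒i≡j s t s-t≡0)
... | inj₂ s-t≡1 = inj₂ (trans (i≡j+[i-j] s t) (trans (cong (_+_ t) s-t≡1) (ℤP.+-comm t 1ℤ)))

select : {A : Set} → (ℤ → A) → (ℤ → A) → ∀ {a} → Parity a → A
select xs ys (even t) = xs t
select xs ys (odd t)  = ys t

interleave : {A : Set} → (ℤ → A) → (ℤ → A) → ℤ → A
interleave xs ys a = select xs ys (parity a)

record Zigzag {A : Set} (R : A → A → Set) (xs ys : ℤ → A) : Set where
  field
    x-y      : ∀ t → R (xs t) (ys t)
    x⁺-y     : ∀ t → R (xs (sucℤ t)) (ys t)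
    x-y-only : ∀ s t → R (xs s) (ys t) → s ≡ t ⊎ s ≡ sucℤ t
    no-x-x   : ∀ s t → ¬ R (xs s) (xs t)
    no-y-y   : ∀ s t → ¬ R (ys s) (ys t)

zigzag-x-y : ∀ {A : Set} {R : A → A → Set} {xs ys} → Zigzag R xs ys → ∀ s t →
  (R (xs s) (ys t) → ∣ s + s - sucℤ (t + t) ∣ ≡ 1) × (∣ s + s - sucℤ (t + t) ∣ ≡ 1 → R (xs s) (ys t))
zigzag-x-y {R = R} {xs} {ys} zz s t =
  (λ r → adjacent-even-odd (x-y-only s t r)) , (λ e → edge (adjacent-even-odd⁻¹ s t e))
  where
  open Zigzag zz
  edge : ∀ {s} → s ≡ t ⊎ s ≡ sucℤ t → R (xs s) (ys t)
  edge (inj₁ refl) = x-y t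
  edge (inj₂ refl) = x⁺-y t

zigzag-induced : ∀ {A : Set} {R : A → A → Set} → (∀ {u v} → R u v → R v u) →
  ∀ {xs ys} → Zigzag R xs ys → IsInducedPath R (interleave xs ys)
zigzag-induced R-sym zz a b with parity a | parity b
... | even s | even t =
  (λ r → ⊥-elim (Zigzag.no-x-x zz s t r)) , (λ e → ⊥-elim (nonadjacent-even-even s t e))
... | odd s  | odd t  =
  (λ r → ⊥-elim (Zigzag.no-y-y zz s t r)) , (λ e → ⊥-elim (nonadjacent-odd-odd s t e))
... | even s | odd t  = zigzag-x-y zz s t
... | odd s  | even t =
  (λ r → trans (ℤP.∣i-j∣≡∣j-i∣ (sucℤ (s + s)) (t + t)) (proj₁ (zigzag-x-y zz t s) (R-sym r))) ,
  (λ e → R-sym (proj₂ (zigzag-x-y zz t s) (trans (ℤP.∣i-j∣≡∣j-i∣ (t + t) (sucℤ (s + s))) e)))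

module _ (ω : ℤ → ℤ) where

  Adj-sym : ∀ {u v} → Adj ω u v → Adj ω v u
  Adj-sym (inj₁ inv) = inj₂ inv
  Adj-sym (inj₂ inv) = inj₁ inv

  Adj-irrefl : ∀ {u} → ¬ Adj ω u u
  Adj-irrefl (inj₁ (u<u , _)) = ℤP.<-irrefl refl u<u
  Adj-irrefl (inj₂ (u<u , _)) = ℤP.<-irrefl refl u<u

  no-inversion-< : ∀ {u v} → u < v → ω u ≤ ω v → ¬ Adj ω u v
  no-inversion-< u<v ωu≤ωv (inj₁ (_ , ωv<ωu)) = ℤP.<⇒≱ ωv<ωu ωu≤ωv
  no-inversion-< u<v ωu≤ωv (inj₂ (v<u , _))   = ℤP.<-asym u<v v<u

  no-inversion-≤ : ∀ {u v} → u ≤ v → ω u < ω v → ¬ Adj ω u v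
  no-inversion-≤ u≤v ωu<ωv (inj₁ (_ , ωv<ωu)) = ℤP.<-asym ωu<ωv ωv<ωu
  no-inversion-≤ u≤v ωu<ωv (inj₂ (v<u , _))   = ℤP.<⇒≱ v<u u≤v

  independent : ∀ {f : ℤ → ℤ} → (∀ {s t} → s < t → ¬ Adj ω (f s) (f t)) →
    ∀ s t → ¬ Adj ω (f s) (f t)
  independent no-edge s t with ℤP.<-cmp s t
  ... | tri< s<t _ _    = no-edge s<t
  ... | tri≈ _ refl _   = Adj-irrefl
  ... | tri> _ _ t<s    = λ adj → no-edge t<s (Adj-sym adj)

Crossing : (ℤ → ℤ) → ℤ → Set
Crossing ω k = ∃[ i ] ∃[ j ] i ≤ k × k < j × ω j < ω i

walk-crosses : ∀ {ω a b} → Walk ω a b → ∀ k → a ≤ k → k < b → Crossing ω k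
walk-crosses here                   k a≤k k<a = ⊥-elim (ℤP.<-irrefl refl (ℤP.≤-<-trans a≤k k<a))
walk-crosses (step {x} {y} x~y w)   k x≤k k<b with k ℤ.<? y
... | no  k≮y = walk-crosses w k (ℤP.≮⇒≥ k≮y) k<b
... | yes k<y with x~y
...   | inj₁ (_ , ωy<ωx) = x , y , x≤k , k<y , ωy<ωx
...   | inj₂ (y<x , _)   = ⊥-elim (ℤP.<-asym k<y (ℤP.<-≤-trans y<x x≤k))

connected⇒crossing : ∀ {ω} → Connected ω → ∀ k → Crossing ω k
connected⇒crossing connected k =
  walk-crosses (connected k (sucℤ k)) k ℤP.≤-refl (ℤP.suc[i]≤j⇒i<j ℤP.≤-refl)

module Staircase (ω : ℤ → ℤ) (ω-bij : Bijective _≡_ _≡_ ω)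
                 (D : ℕ) (displacement : ∀ i → ∣ ω i - i ∣ ℕ.≤ D) where

  ω⁻¹ : ℤ → ℤ
  ω⁻¹ v = proj₁ (proj₂ ω-bij v)

  ω∘ω⁻¹ : ∀ v → ω (ω⁻¹ v) ≡ v
  ω∘ω⁻¹ v = proj₂ (proj₂ ω-bij v) refl

  ω⁻¹∘ω : ∀ i → ω⁻¹ (ω i) ≡ i
  ω⁻¹∘ω i = proj₁ ω-bij (ω∘ω⁻¹ (ω i))

  ω≤ : ∀ i → ω i ≤ i + + D
  ω≤ i = ∣i-j∣≤⇒i≤j+ (displacement i)

  ≤ω : ∀ i → i ≤ ω i + + D
  ≤ω i = ∣i-j∣≤⇒i≤j+ (subst (ℕ._≤ D) (ℤP.∣i-j∣≡∣j-i∣ (ω i) i) (displacement i))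

  -- Values taken at positions ≤ c are at most c + D ≤ ω c + 2D.
  opaque
    max-exists : ∀ c → ∃ (Greatest (λ v → ω⁻¹ v ≤ c))
    max-exists c = greatest _ (λ v → ω⁻¹ v ℤ.≤? c) (ℤP.≤-reflexive (ω⁻¹∘ω c)) (D ℕ.+ D) too-big
      where
      open ℤP.≤-Reasoning
      too-big : ∀ w → ω c + + (D ℕ.+ D) < w → ¬ ω⁻¹ w ≤ c
      too-big w lt ω⁻¹w≤c = ℤP.<-irrefl refl (begin-strict
        ω c + + (D ℕ.+ D)    <⟨ lt ⟩
        w                    ≡⟨ ω∘ω⁻¹ w ⟨
        ω (ω⁻¹ w)            ≤⟨ ω≤ (ω⁻¹ w) ⟩
        ω⁻¹ w + + D          ≤⟨ ℤP.+-monoˡ-≤ (+ D) ω⁻¹w≤c ⟩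
        c + + D              ≤⟨ ℤP.+-monoˡ-≤ (+ D) (≤ω c) ⟩
        ω c + + D + + D      ≡⟨ ℤP.+-assoc (ω c) (+ D) (+ D) ⟩
        ω c + + (D ℕ.+ D)    ∎)

  M : ℤ → ℤ
  M c = proj₁ (max-exists c)

  argmax : ℤ → ℤ
  argmax c = ω⁻¹ (M c)

  argmax≤ : ∀ c → argmax c ≤ c
  argmax≤ c = proj₁ (proj₂ (max-exists c))

  ω-argmax : ∀ c → ω (argmax c) ≡ M c
  ω-argmax c = ω∘ω⁻¹ (M c)

  M-max : ∀ {i c} → i ≤ c → ω i ≤ M c
  M-max {i} {c} i≤c = ℤP.≮⇒≥ λ M<ωi →
    proj₂ (proj₂ (max-exists c)) (ω i) M<ωi (subst (_≤ c) (sym (ω⁻¹∘ω i)) i≤c)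

  M-exceeded : ∀ {i c} → M c < ω i → c < i
  M-exceeded M<ωi = ℤP.≰⇒> λ i≤c → ℤP.<⇒≱ M<ωi (M-max i≤c)

  M-mono : ∀ {c c′} → c ≤ c′ → M c ≤ M c′
  M-mono {c} c≤c′ = subst (_≤ _) (ω-argmax c) (M-max (ℤP.≤-trans (argmax≤ c) c≤c′))

  -- Positions with value below v are below v + D, and v - (D + 1) is one of them.
  opaque
    below-exists : ∀ v → ∃ (Greatest (λ j → ω j < v))
    below-exists v = greatest _ (λ j → ω j ℤ.<? v) ωj₀<v (suc (D ℕ.+ D)) too-big
      where
      open ℤP.≤-Reasoning
      j₀ : ℤ
      j₀ = v - + suc D
      ωj₀<v : ω j₀ < v
      ωj₀<v = ℤP.≤-<-trans (ω≤ j₀) (ℤP.suc[i]≤j⇒i<j (ℤP.≤-reflexive (back (+ D) v)))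
        where
        back : ∀ d v → 1ℤ + (v - (1ℤ + d) + d) ≡ v
        back = solve-∀
      too-big : ∀ j → j₀ + + suc (D ℕ.+ D) < j → ¬ ω j < v
      too-big j lt ωj<v = ℤP.<-irrefl refl (begin-strict
        j                        ≤⟨ ≤ω j ⟩
        ω j + + D                <⟨ ℤP.+-monoˡ-< (+ D) ωj<v ⟩
        v + + D                  ≡⟨ top (+ D) v ⟩
        j₀ + + suc (D ℕ.+ D)     <⟨ lt ⟩
        j                        ∎)
        where
        top : ∀ d v → v + d ≡ v - (1ℤ + d) + (1ℤ + (d + d))
        top = solve-∀

  L : ℤ → ℤ
  L v = proj₁ (below-exists v)

  L-below : ∀ v → ω (L v) < v
  L-below v = proj₁ (proj₂ (below-exists v))

  L-beyond : ∀ {v j} → L v < j → v ≤ ω j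
  L-beyond {v} {j} L<j = ℤP.≮⇒≥ (proj₂ (proj₂ (below-exists v)) j L<j)

  T : ℤ → ℤ
  T c = predℤ (L (M c))

  -- The key step: crossing the cut after L (M c) forces a value above M c at a position
  -- ≤ T c (position L (M c) itself has a value below M c).
  M<M∘T : ∀ {c} → Crossing ω (L (M c)) → M c < M (T c)
  M<M∘T {c} (i , j , i≤L , L<j , ωj<ωi) = ℤP.≰⇒> λ MTc≤Mc → ℤP.<-irrefl refl (begin-strict
    ω j     <⟨ ωj<ωi ⟩
    ω i     ≤⟨ ωi≤Mc MTc≤Mc ⟩
    M c     ≤⟨ L-beyond L<j ⟩
    ω j     ∎)
    where
    open ℤP.≤-Reasoning
    ωi≤Mc : M (T c) ≤ M c → ω i ≤ M c
    ωi≤Mc MTc≤Mc with ≤⇒<⊎≡ i≤L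
    ... | inj₁ i<L  = ℤP.≤-trans (M-max (ℤP.i<j⇒i≤pred[j] i<L)) MTc≤Mc
    ... | inj₂ refl = ℤP.<⇒≤ (L-below (M c))

  c<T : ∀ {c} → Crossing ω (L (M c)) → c < T c
  c<T crossing = ℤP.≰⇒> λ Tc≤c → ℤP.<⇒≱ (M<M∘T crossing) (M-mono Tc≤c)

  module _ {d : ℤ} (ω-d : Commutes ω d) where

    ω⁻¹-d : Commutes ω⁻¹ d
    ω⁻¹-d v = proj₁ ω-bij (begin
      ω (ω⁻¹ (v + d))      ≡⟨ ω∘ω⁻¹ (v + d) ⟩
      v + d                ≡⟨ cong (_+ d) (ω∘ω⁻¹ v) ⟨
      ω (ω⁻¹ v) + d        ≡⟨ ω-d (ω⁻¹ v) ⟨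
      ω (ω⁻¹ v + d)        ∎)
      where open ≡-Reasoning

    M-d : Commutes M d
    M-d c = sym (greatest-unique {λ v → ω⁻¹ v ≤ c + d}
      (greatest-translate {λ v → ω⁻¹ v ≤ c} d shift unshift (proj₂ (max-exists c))) (proj₂ (max-exists (c + d))))
      where
      shift : ∀ v → ω⁻¹ v ≤ c → ω⁻¹ (v + d) ≤ c + d
      shift v le = subst (_≤ c + d) (sym (ω⁻¹-d v)) (ℤP.+-monoˡ-≤ d le)
      unshift : ∀ v → ω⁻¹ v ≤ c + d → ω⁻¹ (v - d) ≤ c
      unshift v le = subst (_≤ c) (sym (commutes-neg ω⁻¹ ω⁻¹-d v)) (≤+d⇒-d≤ d le)

    L-d : Commutes L d
    L-d v = sym (greatest-unique {λ j → ω j < v + d}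
      (greatest-translate {λ j → ω j < v} d shift unshift (proj₂ (below-exists v))) (proj₂ (below-exists (v + d))))
      where
      shift : ∀ j → ω j < v → ω (j + d) < v + d
      shift j lt = subst (_< v + d) (sym (ω-d j)) (ℤP.+-monoˡ-< d lt)
      unshift : ∀ j → ω j < v + d → ω (j - d) < v
      unshift j lt = subst (_< v) (sym (commutes-neg ω ω-d j)) (<+d⇒-d< d lt)

    T-d : Commutes T d
    T-d c = begin
      predℤ (L (M (c + d)))    ≡⟨ cong (λ v → predℤ (L v)) (M-d c) ⟩
      predℤ (L (M c + d))      ≡⟨ cong predℤ (L-d (M c)) ⟩
      predℤ (L (M c) + d)      ≡⟨ ℤP.pred-+ (L (M c)) d ⟨
      predℤ (L (M c)) + d      ∎
      where open ≡-Reasoning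

  -- Along a bi-infinite T-orbit X the positions of the maxima x_t = argmax (X t) and the
  -- positions y_t = L (M (X t)) = X (t + 1) + 1 form a zigzag in the inversion graph.
  module Path (crossing : ∀ k → Crossing ω k)
              (X : ℤ → ℤ) (X-step : ∀ t → X (sucℤ t) ≡ T (X t)) where

    V : ℤ → ℤ
    V t = M (X t)

    xs ys : ℤ → ℤ
    xs t = argmax (X t)
    ys t = L (V t)

    X↑ : Increasing X
    X↑ t = subst (X t <_) (sym (X-step t)) (c<T (crossing _))

    V↑ : Increasing V
    V↑ t = subst (λ c → V t < M c) (sym (X-step t)) (M<M∘T (crossing _))

    ys≡ : ∀ t → ys t ≡ sucℤ (X (sucℤ t))
    ys≡ t = trans (sym (ℤP.suc-pred (ys t))) (cong sucℤ (sym (X-step t)))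

    ys↑ : Increasing ys
    ys↑ t = subst₂ _<_ (sym (ys≡ t)) (sym (ys≡ (sucℤ t))) (ℤP.+-monoʳ-< 1ℤ (X↑ (sucℤ t)))

    X⁺<ys : ∀ t → X (sucℤ t) < ys t
    X⁺<ys t = subst (X (sucℤ t) <_) (sym (ys≡ t)) (ℤP.suc[i]≤j⇒i<j ℤP.≤-refl)

    ω-xs : ∀ t → ω (xs t) ≡ V t
    ω-xs t = ω-argmax (X t)

    -- X t < x_s for t < s, because ω (x_s) = V s exceeds V t, the maximum up to X t.
    X<xs : ∀ {t s} → t < s → X t < xs s
    X<xs t<s = M-exceeded (subst (V _ <_) (sym (ω-xs _)) (increasing⇒< V↑ t<s))

    ω-ys<ω-xs : ∀ {t s} → t ≤ s → ω (ys t) < ω (xs s)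
    ω-ys<ω-xs {t} t≤s =
      subst (ω (ys t) <_) (sym (ω-xs _)) (ℤP.<-≤-trans (L-below (V t)) (increasing⇒≤ V↑ t≤s))

    ω-xs≤ω-ys : ∀ {s t} → s < t → ω (xs s) ≤ ω (ys t)
    ω-xs≤ω-ys {s} s<t = subst (_≤ ω (ys _)) (sym (ω-xs s)) (L-beyond (increasing⇒< ys↑ s<t))

    xs<ys : ∀ {s t} → s ≤ t → xs s < ys t
    xs<ys {s} s≤t = ℤP.<-≤-trans
      (ℤP.≤-<-trans (argmax≤ (X s)) (ℤP.<-trans (X↑ s) (X⁺<ys s))) (increasing⇒≤ ys↑ s≤t)

    xs⁺<ys : ∀ t → xs (sucℤ t) < ys t
    xs⁺<ys t = ℤP.≤-<-trans (argmax≤ _) (X⁺<ys t)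

    x-y-only : ∀ s t → Adj ω (xs s) (ys t) → s ≡ t ⊎ s ≡ sucℤ t
    x-y-only s t adj with ℤP.<-cmp s t
    ... | tri< s<t _ _ = ⊥-elim (no-inversion-< ω (xs<ys (ℤP.<⇒≤ s<t)) (ω-xs≤ω-ys s<t) adj)
    ... | tri≈ _ s≡t _ = inj₁ s≡t
    ... | tri> _ _ t<s with ≤⇒<⊎≡ (ℤP.i<j⇒suc[i]≤j t<s)
    ...   | inj₂ t+1≡s = inj₂ (sym t+1≡s)
    ...   | inj₁ t+1<s = ⊥-elim (no-inversion-≤ ω ys≤xs (ω-ys<ω-xs (ℤP.<⇒≤ t<s)) (Adj-sym ω adj))
      where
      ys≤xs : ys t ≤ xs s
      ys≤xs = subst (_≤ xs s) (sym (ys≡ t)) (ℤP.i<j⇒suc[i]≤j (X<xs t+1<s))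

    zigzag : Zigzag (Adj ω) xs ys
    zigzag = record
      { x-y      = λ t → inj₁ (xs<ys ℤP.≤-refl , ω-ys<ω-xs ℤP.≤-refl)
      ; x⁺-y     = λ t → inj₁ (xs⁺<ys t , ω-ys<ω-xs (ℤP.i≤suc[i] t))
      ; x-y-only = x-y-only
      ; no-x-x   = independent ω λ s<t →
          no-inversion-< ω (ℤP.≤-<-trans (argmax≤ _) (X<xs s<t))
                         (subst₂ _≤_ (sym (ω-xs _)) (sym (ω-xs _)) (ℤP.<⇒≤ (increasing⇒< V↑ s<t)))
      ; no-y-y   = independent ω λ s<t →
          no-inversion-< ω (increasing⇒< ys↑ s<t)
                         (ℤP.<⇒≤ (ℤP.<-≤-trans (L-below _) (L-beyond (increasing⇒< ys↑ s<t))))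
      }

lemma5p5 : (n : ℕ) → 1 ℕ.≤ n → (ω : ℤ → ℤ) → IsAffinePerm n ω →
    Connected ω → HasInducedBiInfinitePath ω
lemma5p5 zero    ()  ω _        _
lemma5p5 (suc m) _   ω ω-affine connected =
  interleave xs ys , induced-path-injective {R = Adj ω} path , path
  where
  open IsAffinePerm ω-affine using (bijective; periodic)

  displacement : ∃[ D ] ∀ i → ∣ ω i - i ∣ ℕ.≤ D
  displacement = bounded-displacement (suc m) ω periodic

  open Staircase ω bijective (proj₁ displacement) (proj₂ displacement)

  orbit : ∃[ X ] ∀ t → X (sucℤ t) ≡ T (X t)
  orbit = bi-infinite-orbit (suc m) T (T-d periodic)

  open Path (connected⇒crossing connected) (proj₁ orbit) (proj₂ orbit)

  path : IsInducedPath (Adj ω) (interleave xs ys)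
  path = zigzag-induced (Adj-sym ω) zigzag
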